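{- Let $\mathcal{C}=\langle F_1,\dots,F_t\rangle$ be a pure simplicial complex, let $H$ be a set disjoint from the vertex set of $\mathcal{C}$, and let $\mathcal{D}=\langle F_1\cup H,\dots,F_t\cup H\rangle$. Then for every $k$, $\mathcal{C}$ is $k$-decomposable if and only if $\mathcal{D}$ is $k$-decomposable; and for every set $F$, $F$ is a shedding face of $\mathcal{C}$ if and only if $F$ is a shedding face of $\mathcal{D}$.
   Context: $\langle F_1,\dots,F_t\rangle$ is the simplicial complex with facets $F_1,\dots,F_t$. For a nonempty face $F$: $\mathrm{lk}_F\mathcal{C}=\{G\in\mathcal{C}: G\cap F=\emptyset, G\cup F\in\mathcal{C}\}$, $\mathrm{del}_F\mathcal{C}=\{G\in\mathcal{C}: F\not\subseteq G\}$. A face $F$ of a pure $d$-dimensional complex $\mathcal{C}$ is a shedding face if $\mathrm{del}_F\mathcal{C}$ is pure of dimension $d$. A pure $d$-dimensional complex is $k$-decomposable if it is a simplex (one facet), or it has a shedding face $F$ with $\dim F=|F|-1\le k$ such that $\mathrm{del}_F\mathcal{C}$ and $\mathrm{lk}_F\mathcal{C}$ are $k$-decomposable. -}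

module Defs where

open import Data.Nat using (ℕ; _≤_; suc)
open import Data.Fin.Subset using (Subset; _⊆_; _∪_; _∩_; ∣_∣; Nonempty; _∈_; _∉_)
open import Data.List using (List)
open import Data.List.Membership.Propositional using () renaming (_∈_ to _∈ₗ_)
open import Data.Product using (Σ; ∃; _×_; ∃-syntax)
open import Relation.Binary.PropositionalEquality using (_≡_)
open import Relation.Nullary using (¬_)

SC : ℕ → Set₁
SC n = Subset n → Set

⟨_⟩ : ∀ {n} → List (Subset n) → SC n
⟨ Fs ⟩ G = ∃[ F ] (F ∈ₗ Fs × G ⊆ F)

Facet : ∀ {n} → SC n → Subset n → Set
Facet C G = C G × (∀ G′ → C G′ → G ⊆ G′ → G ≡ G′)

-- Pure of dimension s - 1 (s = cardinality of faces of maximal size):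
-- there is a face with s vertices, every face has at most s vertices,
-- and every facet has exactly s vertices.
Pure : ∀ {n} → ℕ → SC n → Set
Pure s C = (∃[ G ] (C G × ∣ G ∣ ≡ s))
         × (∀ G → C G → ∣ G ∣ ≤ s)
         × (∀ G → Facet C G → ∣ G ∣ ≡ s)

Disjoint : ∀ {n} → Subset n → Subset n → Set
Disjoint {n} A B = ∀ x → x ∈ A → x ∉ B

del : ∀ {n} → Subset n → SC n → SC n
del F C G = C G × ¬ (F ⊆ G)

lk : ∀ {n} → Subset n → SC n → SC n
lk F C G = C G × Disjoint G F × C (G ∪ F)

ShedFace : ∀ {n} → SC n → Subset n → Set
ShedFace C F = ∃[ s ] (Pure s C × C F × Nonempty F × Pure s (del F C))

IsSimplex : ∀ {n} → SC n → Set
IsSimplex C = ∃[ σ ] (Facet C σ × (∀ G → Facet C G → G ≡ σ))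

-- k-decomposability (dim F = |F| - 1 ≤ k  ⇔  |F| ≤ k + 1)
data Decomp {n} (k : ℕ) : SC n → Set₁ where
  simplex : ∀ {C} s → Pure s C → IsSimplex C → Decomp k C
  shed    : ∀ {C} s F → Pure s C → C F → Nonempty F → ∣ F ∣ ≤ suc k
          → Pure s (del F C)
          → Decomp k (del F C) → Decomp k (lk F C) → Decomp k C

{-# OPTIONS --safe #-}
-- Since H avoids the vertices of C, the complex D = ⟨F₁ ∪ H, …, F_t ∪ H⟩ is the join of C with
-- the simplex on H: G ∈ D iff G ∖ H ∈ C.  Facets correspond via τ ↦ τ ∪ H, so purity and
-- being a simplex transfer (shifting sizes by ∣H∣), and for F disjoint from H deletion and
-- link commute with the join.  The one new point is that a shedding face F of D cannot meet
-- H: for x ∈ F ∩ H, removing x from a facet τ ∪ H of D containing F gives a facet of del_F D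
-- that is one vertex too small, so del_F D is not pure.  Induction on decompositions then
-- transfers k-decomposability in both directions.
module Submission where

open import Defs
open import Data.Nat using (ℕ)
open import Data.Fin.Subset using (Subset; _∪_)
open import Data.List using (List; map)
open import Data.List.Membership.Propositional using (_∈_)
open import Data.Product using (_×_; ∃-syntax)
open import Function.Bundles using (_⇔_)

open import Data.Nat using (zero; suc; _+_; _∸_; _≤_; _<_)
open import Data.Nat.Properties
  using (≤-trans; ≤-reflexive; +-monoˡ-≤; +-monoʳ-≤; +-suc; m+n≤o⇒m≤o∸n; m+n∸n≡m; <⇒≱; m≤m+n)
open import Data.Fin using (Fin; zero; suc; _≟_)
open import Data.Fin.Subset
  using (_─_; _-_; ⁅_⁆; _⊆_; _⊂_; ∣_∣; inside; outside)
  renaming (_∈_ to _∈ₛ_; _∉_ to _∉ₛ_)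
open import Data.Fin.Subset.Properties
  using (_∈?_; ⊆-antisym; ⊆-trans; p⊆p∪q; q⊆p∪q; x∈p∪q⁺; x∈p∪q⁻; p─q⊆p; x∈p∧x∉q⇒x∈p─q;
         p⊆q⇒∣p∣≤∣q∣; p⊂q⇒∣p∣<∣q∣; p─q─r≡p─r─q; x∈p∧x≢y⇒x∈p-y; x∈p⇒∣p-x∣<∣p∣;
         x∈⁅x⁆; x∈⁅y⁆⇒x≡y; ⊆-reflexive)
open import Data.Vec.Base using ([]; _∷_; here; there)
open import Data.Product using (_,_; proj₁; proj₂)
open import Data.Sum using (inj₁; inj₂)
open import Data.Empty using (⊥-elim)
open import Function.Base using (id; _∘_)
open import Relation.Nullary using (¬_; yes; no)
open import Relation.Binary.PropositionalEquality
  using (_≡_; refl; sym; trans; cong; subst; module ≡-Reasoning)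
open import Relation.Unary using (_≐_)
open import Relation.Unary.Properties using (≐-sym; ≐-trans)
open import Data.List.Membership.Propositional.Properties using (∈-map⁺; ∈-map⁻)
open import Function.Bundles using (mk⇔)

private
  variable
    n : ℕ
    p q r : Subset n
    x : Fin n
    s k : ℕ
    F G H τ : Subset n
    X Y : SC n

x∈p─q⇒x∉q : ∀ (p q : Subset n) → x ∈ₛ p ─ q → x ∉ₛ q
x∈p─q⇒x∉q (_ ∷ p) (outside ∷ q) here          ()
x∈p─q⇒x∉q (_ ∷ p) (_       ∷ q) (there x∈p─q) (there x∈q) = x∈p─q⇒x∉q p q x∈p─q x∈q

p─q-disjoint : ∀ (p q : Subset n) → Disjoint (p ─ q) q
p─q-disjoint p q _ = x∈p─q⇒x∉q p q

─-monoˡ-⊆ : ∀ (r : Subset n) → p ⊆ q → p ─ r ⊆ q ─ r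
─-monoˡ-⊆ {p = p} r p⊆q x∈p─r =
  x∈p∧x∉q⇒x∈p─q (p⊆q (p─q⊆p p r x∈p─r)) (x∈p─q⇒x∉q p r x∈p─r)

p⊆p─q∪q : ∀ (p q : Subset n) → p ⊆ (p ─ q) ∪ q
p⊆p─q∪q p q {x} x∈p with x ∈? q
... | yes x∈q = x∈p∪q⁺ (inj₂ x∈q)
... | no  x∉q = x∈p∪q⁺ (inj₁ (x∈p∧x∉q⇒x∈p─q x∈p x∉q))

∪-monoˡ-⊆ : ∀ (r : Subset n) → p ⊆ q → p ∪ r ⊆ q ∪ r
∪-monoˡ-⊆ {p = p} r p⊆q x∈p∪r with x∈p∪q⁻ p r x∈p∪r
... | inj₁ x∈p = x∈p∪q⁺ (inj₁ (p⊆q x∈p))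
... | inj₂ x∈r = x∈p∪q⁺ (inj₂ x∈r)

p─r⊆q⇒p⊆q∪r : ∀ (r : Subset n) → p ─ r ⊆ q → p ⊆ q ∪ r
p─r⊆q⇒p⊆q∪r {p = p} r p─r⊆q = ⊆-trans (p⊆p─q∪q p r) (∪-monoˡ-⊆ r p─r⊆q)

p⊆q∪r⇒p─r⊆q : ∀ (r : Subset n) → p ⊆ q ∪ r → p ─ r ⊆ q
p⊆q∪r⇒p─r⊆q {p = p} {q} r p⊆q∪r x∈p─r with x∈p∪q⁻ q r (p⊆q∪r (p─q⊆p p r x∈p─r))
... | inj₁ x∈q = x∈q
... | inj₂ x∈r = ⊥-elim (x∈p─q⇒x∉q p r x∈p─r x∈r)

disjoint⇒⊆─ : Disjoint p q → p ⊆ r → p ⊆ r ─ q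
disjoint⇒⊆─ p#q p⊆r x∈p = x∈p∧x∉q⇒x∈p─q (p⊆r x∈p) (p#q _ x∈p)

disjoint⇒p─q≡p : Disjoint p q → p ─ q ≡ p
disjoint⇒p─q≡p {p = p} {q} p#q = ⊆-antisym (p─q⊆p p q) (disjoint⇒⊆─ p#q id)

q⊆p⇒p─q∪q≡p : q ⊆ p → (p ─ q) ∪ q ≡ p
q⊆p⇒p─q∪q≡p {q = q} {p} q⊆p = ⊆-antisym ⊆p (p⊆p─q∪q p q)
  where
  ⊆p : (p ─ q) ∪ q ⊆ p
  ⊆p x∈ with x∈p∪q⁻ (p ─ q) q x∈
  ... | inj₁ x∈p─q = p─q⊆p p q x∈p─q
  ... | inj₂ x∈q   = q⊆p x∈q

p∪q─q≡p─q : ∀ (p q : Subset n) → (p ∪ q) ─ q ≡ p ─ q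
p∪q─q≡p─q []            []            = refl
p∪q─q≡p─q (_       ∷ p) (inside  ∷ q) = cong (outside ∷_) (p∪q─q≡p─q p q)
p∪q─q≡p─q (inside  ∷ p) (outside ∷ q) = cong (inside ∷_) (p∪q─q≡p─q p q)
p∪q─q≡p─q (outside ∷ p) (outside ∷ q) = cong (outside ∷_) (p∪q─q≡p─q p q)

disjoint⇒p∪q─q≡p : Disjoint p q → (p ∪ q) ─ q ≡ p
disjoint⇒p∪q─q≡p {p = p} {q} p#q = trans (p∪q─q≡p─q p q) (disjoint⇒p─q≡p p#q)

─-distribʳ-∪ : ∀ (p q r : Subset n) → (p ∪ q) ─ r ≡ (p ─ r) ∪ (q ─ r)
─-distribʳ-∪ []      []      []            = refl
─-distribʳ-∪ (_ ∷ p) (_ ∷ q) (inside  ∷ r) = cong (outside ∷_) (─-distribʳ-∪ p q r)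
─-distribʳ-∪ (_ ∷ p) (_ ∷ q) (outside ∷ r) = cong (_ ∷_) (─-distribʳ-∪ p q r)

drop-∷-Disjoint : ∀ {a b} → Disjoint (a ∷ p) (b ∷ q) → Disjoint p q
drop-∷-Disjoint ap#bq x x∈p x∈q = ap#bq (suc x) (there x∈p) (there x∈q)

∣p∪q∣≡∣p∣+∣q∣ : ∀ (p q : Subset n) → Disjoint p q → ∣ p ∪ q ∣ ≡ ∣ p ∣ + ∣ q ∣
∣p∪q∣≡∣p∣+∣q∣ []            []            _   = refl
∣p∪q∣≡∣p∣+∣q∣ (inside  ∷ p) (inside  ∷ q) p#q = ⊥-elim (p#q zero here here)
∣p∪q∣≡∣p∣+∣q∣ (inside  ∷ p) (outside ∷ q) p#q = cong suc (∣p∪q∣≡∣p∣+∣q∣ p q (drop-∷-Disjoint p#q))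
∣p∪q∣≡∣p∣+∣q∣ (outside ∷ p) (inside  ∷ q) p#q =
  trans (cong suc (∣p∪q∣≡∣p∣+∣q∣ p q (drop-∷-Disjoint p#q))) (sym (+-suc ∣ p ∣ ∣ q ∣))
∣p∪q∣≡∣p∣+∣q∣ (outside ∷ p) (outside ∷ q) p#q = ∣p∪q∣≡∣p∣+∣q∣ p q (drop-∷-Disjoint p#q)

∣p∣≤∣p─q∣+∣q∣ : ∀ (p q : Subset n) → ∣ p ∣ ≤ ∣ p ─ q ∣ + ∣ q ∣
∣p∣≤∣p─q∣+∣q∣ p q = ≤-trans (p⊆q⇒∣p∣≤∣q∣ (p⊆p─q∪q p q))
                            (≤-reflexive (∣p∪q∣≡∣p∣+∣q∣ (p ─ q) q (p─q-disjoint p q)))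

q⊆p⇒∣p∣≡∣p─q∣+∣q∣ : q ⊆ p → ∣ p ∣ ≡ ∣ p ─ q ∣ + ∣ q ∣
q⊆p⇒∣p∣≡∣p─q∣+∣q∣ {q = q} {p} q⊆p = begin
  ∣ p ∣             ≡⟨ cong ∣_∣ (q⊆p⇒p─q∪q≡p q⊆p) ⟨
  ∣ (p ─ q) ∪ q ∣   ≡⟨ ∣p∪q∣≡∣p∣+∣q∣ (p ─ q) q (p─q-disjoint p q) ⟩
  ∣ p ─ q ∣ + ∣ q ∣ ∎
  where open ≡-Reasoning

⊆∧⊄⇒≡ : p ⊆ q → ¬ (p ⊂ q) → p ≡ q
⊆∧⊄⇒≡ {p = p} {q} p⊆q p⊄q = ⊆-antisym p⊆q q⊆p
  where
  q⊆p : q ⊆ p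
  q⊆p {x} x∈q with x ∈? p
  ... | yes x∈p = x∈p
  ... | no  x∉p = ⊥-elim (p⊄q (p⊆q , x , x∈q , x∉p))

⊆∧∣⊇∣⇒≡ : p ⊆ q → ∣ q ∣ ≤ ∣ p ∣ → p ≡ q
⊆∧∣⊇∣⇒≡ p⊆q ∣q∣≤∣p∣ = ⊆∧⊄⇒≡ p⊆q (λ p⊂q → <⇒≱ (p⊂q⇒∣p∣<∣q∣ p⊂q) ∣q∣≤∣p∣)

-- Faces form an arbitrary predicate, so a facet above a face only exists up to double
-- negation; that suffices, as it is only used to reach a contradiction.  In go, the fuel m
-- bounds the length of any strictly increasing chain of faces starting at G.
module _ {X : SC n} {b : ℕ} (bounded : ∀ G → X G → ∣ G ∣ ≤ b) where

  ¬¬-facet-⊇ : X G → ¬ ¬ (∃[ τ ] (Facet X τ × G ⊆ τ))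
  ¬¬-facet-⊇ {G = G} = go b (m≤m+n b ∣ G ∣)
    where
    go : ∀ m {G} → b ≤ m + ∣ G ∣ → X G → ¬ ¬ (∃[ τ ] (Facet X τ × G ⊆ τ))
    go m {G} b≤m+∣G∣ XG no-facet = no-facet (G , (XG , maximal) , id)
      where
      maximal : ∀ G′ → X G′ → G ⊆ G′ → G ≡ G′
      maximal G′ XG′ G⊆G′ = ⊆∧⊄⇒≡ G⊆G′ (not-proper m b≤m+∣G∣)
        where
        not-proper : ∀ m → b ≤ m + ∣ G ∣ → ¬ (G ⊂ G′)
        not-proper zero    b≤∣G∣   G⊂G′ =
          <⇒≱ (p⊂q⇒∣p∣<∣q∣ G⊂G′) (≤-trans (bounded G′ XG′) b≤∣G∣)
        not-proper (suc m) b≤1+m+∣G∣ G⊂G′ = go m b≤m+∣G′∣ XG′ λ (τ , τ-facet , G′⊆τ) →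
          no-facet (τ , τ-facet , ⊆-trans G⊆G′ G′⊆τ)
          where
          b≤m+∣G′∣ : b ≤ m + ∣ G′ ∣
          b≤m+∣G′∣ = ≤-trans b≤1+m+∣G∣
            (≤-trans (≤-reflexive (sym (+-suc m ∣ G ∣))) (+-monoʳ-≤ m (p⊂q⇒∣p∣<∣q∣ G⊂G′)))

Facet-resp-≐ : X ≐ Y → Facet X G → Facet Y G
Facet-resp-≐ (X⊆Y , Y⊆X) (XG , maximal) = X⊆Y XG , λ G′ YG′ → maximal G′ (Y⊆X YG′)

Pure-resp-≐ : X ≐ Y → Pure s X → Pure s Y
Pure-resp-≐ X≐Y@(X⊆Y , Y⊆X) ((G , XG , ∣G∣≡s) , bounded , facet-size) =
    (G , X⊆Y XG , ∣G∣≡s)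
  , (λ G′ YG′ → bounded G′ (Y⊆X YG′))
  , (λ G′ → facet-size G′ ∘ Facet-resp-≐ (≐-sym X≐Y))

IsSimplex-resp-≐ : X ≐ Y → IsSimplex X → IsSimplex Y
IsSimplex-resp-≐ X≐Y (σ , σ-facet , unique) =
  σ , Facet-resp-≐ X≐Y σ-facet , λ G → unique G ∘ Facet-resp-≐ (≐-sym X≐Y)

del-resp-≐ : X ≐ Y → del F X ≐ del F Y
del-resp-≐ (X⊆Y , Y⊆X) = (λ (XG , F⊈G) → X⊆Y XG , F⊈G) , (λ (YG , F⊈G) → Y⊆X YG , F⊈G)

lk-resp-≐ : X ≐ Y → lk F X ≐ lk F Y
lk-resp-≐ (X⊆Y , Y⊆X) = (λ (XG , G#F , XG∪F) → X⊆Y XG , G#F , X⊆Y XG∪F)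
                      , (λ (YG , G#F , YG∪F) → Y⊆X YG , G#F , Y⊆X YG∪F)

Decomp-resp-≐ : X ≐ Y → Decomp k X → Decomp k Y
Decomp-resp-≐ X≐Y (simplex s P X-simplex) =
  simplex s (Pure-resp-≐ X≐Y P) (IsSimplex-resp-≐ X≐Y X-simplex)
Decomp-resp-≐ X≐Y (shed s F P XF F≢∅ ∣F∣≤1+k Pdel del-decomp lk-decomp) =
  shed s F (Pure-resp-≐ X≐Y P) (proj₁ X≐Y XF) F≢∅ ∣F∣≤1+k (Pure-resp-≐ (del-resp-≐ X≐Y) Pdel)
    (Decomp-resp-≐ (del-resp-≐ X≐Y) del-decomp) (Decomp-resp-≐ (lk-resp-≐ X≐Y) lk-decomp)

ShedFace-resp-≐ : X ≐ Y → ShedFace X F → ShedFace Y F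
ShedFace-resp-≐ X≐Y (s , P , XF , F≢∅ , Pdel) =
  s , Pure-resp-≐ X≐Y P , proj₁ X≐Y XF , F≢∅ , Pure-resp-≐ (del-resp-≐ X≐Y) Pdel

-- The join of X with the simplex on H (a join in the usual sense when X avoids H).
_⋆_ : SC n → Subset n → SC n
(X ⋆ H) G = X (G ─ H)

_Avoids_ : SC n → Subset n → Set
X Avoids H = ∀ {G} → X G → Disjoint G H

⋆-face⁺ : Disjoint F H → X F → (X ⋆ H) F
⋆-face⁺ {X = X} F#H = subst X (sym (disjoint⇒p─q≡p F#H))

⋆-face⁻ : Disjoint F H → (X ⋆ H) F → X F
⋆-face⁻ {X = X} F#H = subst X (disjoint⇒p─q≡p F#H)

⋆-saturate : (X ⋆ H) G → (X ⋆ H) (G ∪ H)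
⋆-saturate {X = X} {H} {G} = subst X (sym (p∪q─q≡p─q G H))

⋆-lift : X Avoids H → X G → (X ⋆ H) (G ∪ H)
⋆-lift {X = X} avoid XG = ⋆-saturate {X = X} (⋆-face⁺ {X = X} (avoid XG) XG)

Facet-⋆-⊇ : Facet (X ⋆ H) G → H ⊆ G
Facet-⋆-⊇ {X = X} {H} {G} (XG─H , maximal) =
  subst (H ⊆_) (sym (maximal (G ∪ H) (⋆-saturate {X = X} XG─H) (p⊆p∪q H))) (q⊆p∪q G H)

Facet-⋆⁺ : X Avoids H → Facet X G → Facet (X ⋆ H) (G ∪ H)
Facet-⋆⁺ {X = X} {H} {G} avoid (XG , maximal) = ⋆-lift avoid XG , maximal′
  where
  maximal′ : ∀ G′ → (X ⋆ H) G′ → G ∪ H ⊆ G′ → G ∪ H ≡ G′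
  maximal′ G′ XG′─H G∪H⊆G′ = ⊆-antisym G∪H⊆G′ (p─r⊆q⇒p⊆q∪r H (⊆-reflexive (sym G≡G′─H)))
    where
    G≡G′─H : G ≡ G′ ─ H
    G≡G′─H = maximal (G′ ─ H) XG′─H (disjoint⇒⊆─ (avoid XG) (⊆-trans (p⊆p∪q H) G∪H⊆G′))

Facet-⋆⁻ : X Avoids H → Facet (X ⋆ H) G → Facet X (G ─ H)
Facet-⋆⁻ {X = X} {H} {G} avoid (XG─H , maximal) = XG─H , maximal′
  where
  maximal′ : ∀ G′ → X G′ → G ─ H ⊆ G′ → G ─ H ≡ G′
  maximal′ G′ XG′ G─H⊆G′ = begin
    G ─ H          ≡⟨ cong (_─ H) (maximal (G′ ∪ H) (⋆-lift avoid XG′) (p─r⊆q⇒p⊆q∪r H G─H⊆G′)) ⟩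
    (G′ ∪ H) ─ H   ≡⟨ disjoint⇒p∪q─q≡p (avoid XG′) ⟩
    G′             ∎
    where open ≡-Reasoning

Pure-⋆⁺ : X Avoids H → Pure s X → Pure (s + ∣ H ∣) (X ⋆ H)
Pure-⋆⁺ {X = X} {H} {s} avoid ((G , XG , ∣G∣≡s) , bounded , facet-size) =
    (G ∪ H , ⋆-lift avoid XG , trans (∣p∪q∣≡∣p∣+∣q∣ G H (avoid XG)) (cong (_+ ∣ H ∣) ∣G∣≡s))
  , bounded′
  , facet-size′
  where
  bounded′ : ∀ G′ → (X ⋆ H) G′ → ∣ G′ ∣ ≤ s + ∣ H ∣
  bounded′ G′ XG′─H = ≤-trans (∣p∣≤∣p─q∣+∣q∣ G′ H) (+-monoˡ-≤ ∣ H ∣ (bounded (G′ ─ H) XG′─H))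

  facet-size′ : ∀ G′ → Facet (X ⋆ H) G′ → ∣ G′ ∣ ≡ s + ∣ H ∣
  facet-size′ G′ G′-facet = trans (q⊆p⇒∣p∣≡∣p─q∣+∣q∣ (Facet-⋆-⊇ {X = X} G′-facet))
                                  (cong (_+ ∣ H ∣) (facet-size (G′ ─ H) (Facet-⋆⁻ avoid G′-facet)))

Pure-⋆⁻ : X Avoids H → Pure s (X ⋆ H) → Pure (s ∸ ∣ H ∣) X
Pure-⋆⁻ {X = X} {H} {s} avoid ((G , XG─H , ∣G∣≡s) , bounded , facet-size) =
    (G ─ H , XG─H , +∣H∣≡s⇒≡s∸∣H∣ (trans (sym (q⊆p⇒∣p∣≡∣p─q∣+∣q∣ H⊆G)) ∣G∣≡s))
  , (λ G′ XG′ → m+n≤o⇒m≤o∸n ∣ G′ ∣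
                   (subst (_≤ s) (∣G′∪H∣≡∣G′∣+∣H∣ XG′) (bounded (G′ ∪ H) (⋆-lift avoid XG′))))
  , (λ G′ G′-facet → +∣H∣≡s⇒≡s∸∣H∣ (trans (sym (∣G′∪H∣≡∣G′∣+∣H∣ (proj₁ G′-facet)))
                                          (facet-size (G′ ∪ H) (Facet-⋆⁺ avoid G′-facet))))
  where
  +∣H∣≡s⇒≡s∸∣H∣ : ∀ {m} → m + ∣ H ∣ ≡ s → m ≡ s ∸ ∣ H ∣
  +∣H∣≡s⇒≡s∸∣H∣ {m} m+∣H∣≡s = trans (sym (m+n∸n≡m m ∣ H ∣)) (cong (_∸ ∣ H ∣) m+∣H∣≡s)

  ∣G′∪H∣≡∣G′∣+∣H∣ : ∀ {G′} → X G′ → ∣ G′ ∪ H ∣ ≡ ∣ G′ ∣ + ∣ H ∣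
  ∣G′∪H∣≡∣G′∣+∣H∣ {G′} XG′ = ∣p∪q∣≡∣p∣+∣q∣ G′ H (avoid XG′)

  H⊆G : H ⊆ G
  H⊆G = subst (H ⊆_) (sym (⊆∧∣⊇∣⇒≡ (p⊆p∪q H) ∣G∪H∣≤∣G∣)) (q⊆p∪q G H)
    where
    ∣G∪H∣≤∣G∣ : ∣ G ∪ H ∣ ≤ ∣ G ∣
    ∣G∪H∣≤∣G∣ = subst (∣ G ∪ H ∣ ≤_) (sym ∣G∣≡s) (bounded (G ∪ H) (⋆-saturate {X = X} XG─H))

IsSimplex-⋆⁺ : X Avoids H → IsSimplex X → IsSimplex (X ⋆ H)
IsSimplex-⋆⁺ {X = X} {H} avoid (σ , σ-facet , unique) =
  σ ∪ H , Facet-⋆⁺ avoid σ-facet , λ G G-facet → begin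
    G            ≡⟨ q⊆p⇒p─q∪q≡p (Facet-⋆-⊇ {X = X} G-facet) ⟨
    (G ─ H) ∪ H  ≡⟨ cong (_∪ H) (unique (G ─ H) (Facet-⋆⁻ avoid G-facet)) ⟩
    σ ∪ H        ∎
  where open ≡-Reasoning

IsSimplex-⋆⁻ : X Avoids H → IsSimplex (X ⋆ H) → IsSimplex X
IsSimplex-⋆⁻ {H = H} avoid (τ , τ-facet , unique) =
  τ ─ H , Facet-⋆⁻ avoid τ-facet , λ G G-facet → begin
    G            ≡⟨ disjoint⇒p∪q─q≡p (avoid (proj₁ G-facet)) ⟨
    (G ∪ H) ─ H  ≡⟨ cong (_─ H) (unique (G ∪ H) (Facet-⋆⁺ avoid G-facet)) ⟩
    τ ─ H        ∎
  where open ≡-Reasoning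

del-⋆ : Disjoint F H → del F (X ⋆ H) ≐ del F X ⋆ H
del-⋆ {H = H} F#H = (λ (XG─H , F⊈G) → XG─H , λ F⊆G─H → F⊈G (⊆-trans F⊆G─H (p─q⊆p _ H)))
                  , (λ (XG─H , F⊈G─H) → XG─H , λ F⊆G → F⊈G─H (disjoint⇒⊆─ F#H F⊆G))

lk-⋆ : Disjoint F H → lk F (X ⋆ H) ≐ lk F X ⋆ H
lk-⋆ {F = F} {H} {X} F#H =
    (λ (XG─H , G#F , XG∪F─H) → XG─H , #F-─H⁺ G#F , subst X (∪-─ _) XG∪F─H)
  , (λ (XG─H , G─H#F , XG─H∪F) → XG─H , #F-─H⁻ G─H#F , subst X (sym (∪-─ _)) XG─H∪F)
  where
  ∪-─ : ∀ G → (G ∪ F) ─ H ≡ (G ─ H) ∪ F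
  ∪-─ G = trans (─-distribʳ-∪ G F H) (cong ((G ─ H) ∪_) (disjoint⇒p─q≡p F#H))

  #F-─H⁺ : ∀ {G} → Disjoint G F → Disjoint (G ─ H) F
  #F-─H⁺ {G} G#F x x∈G─H = G#F x (p─q⊆p G H x∈G─H)

  #F-─H⁻ : ∀ {G} → Disjoint (G ─ H) F → Disjoint G F
  #F-─H⁻ G─H#F x x∈G x∈F = G─H#F x (x∈p∧x∉q⇒x∈p─q x∈G (F#H x x∈F)) x∈F

Facet-del-⋆-punctured : X Avoids H → Facet X τ → F ─ H ⊆ τ → x ∈ₛ F → x ∈ₛ H →
                        Facet (del F (X ⋆ H)) ((τ ∪ H) - x)
Facet-del-⋆-punctured {X = X} {H} {τ} {F} {x} avoid (Xτ , τ-maximal) F─H⊆τ x∈F x∈H =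
  (subst X (sym K─H≡τ) Xτ , λ F⊆K → x∉K (F⊆K x∈F)) , maximal
  where
  K : Subset _
  K = (τ ∪ H) - x

  x∉τ : x ∉ₛ τ
  x∉τ x∈τ = avoid Xτ x x∈τ x∈H

  x∉K : x ∉ₛ K
  x∉K x∈K = x∈p─q⇒x∉q (τ ∪ H) ⁅ x ⁆ x∈K (x∈⁅x⁆ x)

  K─H≡τ : K ─ H ≡ τ
  K─H≡τ = begin
    (τ ∪ H) ─ ⁅ x ⁆ ─ H  ≡⟨ p─q─r≡p─r─q (τ ∪ H) ⁅ x ⁆ H ⟩
    (τ ∪ H) ─ H - x      ≡⟨ cong (_- x) (disjoint⇒p∪q─q≡p (avoid Xτ)) ⟩
    τ - x                ≡⟨ disjoint⇒p─q≡p τ#⁅x⁆ ⟩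
    τ                    ∎
    where
    open ≡-Reasoning
    τ#⁅x⁆ : Disjoint τ ⁅ x ⁆
    τ#⁅x⁆ y y∈τ y∈⁅x⁆ = x∉τ (subst (_∈ₛ τ) (x∈⁅y⁆⇒x≡y x y∈⁅x⁆) y∈τ)

  maximal : ∀ G′ → del F (X ⋆ H) G′ → K ⊆ G′ → K ≡ G′
  maximal G′ (XG′─H , F⊈G′) K⊆G′ = ⊆-antisym K⊆G′ G′⊆K
    where
    τ≡G′─H : τ ≡ G′ ─ H
    τ≡G′─H = τ-maximal (G′ ─ H) XG′─H (subst (_⊆ G′ ─ H) K─H≡τ (─-monoˡ-⊆ H K⊆G′))

    x∉G′ : x ∉ₛ G′
    x∉G′ x∈G′ = F⊈G′ F⊆G′
      where
      F⊆G′ : F ⊆ G′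
      F⊆G′ {y} y∈F with y ≟ x
      ... | yes refl = x∈G′
      ... | no  y≢x  = K⊆G′ (x∈p∧x≢y⇒x∈p-y (p─r⊆q⇒p⊆q∪r H F─H⊆τ y∈F) y≢x)

    G′⊆K : G′ ⊆ K
    G′⊆K y∈G′ = x∈p∧x≢y⇒x∈p-y (p─r⊆q⇒p⊆q∪r H (⊆-reflexive (sym τ≡G′─H)) y∈G′)
                              (λ y≡x → x∉G′ (subst (_∈ₛ G′) y≡x y∈G′))

⋆-shedding-face-disjoint : X Avoids H → Pure s (X ⋆ H) → (X ⋆ H) F → Pure s (del F (X ⋆ H)) →
                           Disjoint F H
⋆-shedding-face-disjoint {X = X} {H} {s} {F} avoid P XF─H Pdel x x∈F x∈H =
  ¬¬-facet-⊇ (proj₁ (proj₂ (Pure-⋆⁻ avoid P))) XF─H λ (τ , τ-facet , F─H⊆τ) →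
    <⇒≱ (∣punctured∣<s τ-facet) (≤-reflexive (sym (∣punctured∣≡s τ-facet F─H⊆τ)))
  where
  ∣punctured∣≡s : Facet X τ → F ─ H ⊆ τ → ∣ (τ ∪ H) - x ∣ ≡ s
  ∣punctured∣≡s τ-facet F─H⊆τ =
    proj₂ (proj₂ Pdel) _ (Facet-del-⋆-punctured avoid τ-facet F─H⊆τ x∈F x∈H)

  ∣punctured∣<s : Facet X τ → ∣ (τ ∪ H) - x ∣ < s
  ∣punctured∣<s {τ} (Xτ , _) =
    ≤-trans (x∈p⇒∣p-x∣<∣p∣ (x∈p∪q⁺ {p = τ} (inj₂ x∈H))) (proj₁ (proj₂ P) (τ ∪ H) (⋆-lift avoid Xτ))

Pure-del-⋆⁺ : X Avoids H → Disjoint F H → Pure s (del F X) → Pure (s + ∣ H ∣) (del F (X ⋆ H))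
Pure-del-⋆⁺ {X = X} avoid F#H = Pure-resp-≐ (≐-sym (del-⋆ {X = X} F#H)) ∘ Pure-⋆⁺ (avoid ∘ proj₁)

Pure-del-⋆⁻ : X Avoids H → Disjoint F H → Pure s (del F (X ⋆ H)) → Pure (s ∸ ∣ H ∣) (del F X)
Pure-del-⋆⁻ {X = X} avoid F#H = Pure-⋆⁻ (avoid ∘ proj₁) ∘ Pure-resp-≐ (del-⋆ {X = X} F#H)

ShedFace-⋆⁺ : X Avoids H → ShedFace X F → ShedFace (X ⋆ H) F
ShedFace-⋆⁺ {X = X} {H} {F} avoid (s , P , XF , F≢∅ , Pdel) =
  _ , Pure-⋆⁺ avoid P , ⋆-face⁺ {X = X} F#H XF , F≢∅ , Pure-del-⋆⁺ avoid F#H Pdel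
  where
  F#H : Disjoint F H
  F#H = avoid XF

ShedFace-⋆⁻ : X Avoids H → ShedFace (X ⋆ H) F → ShedFace X F
ShedFace-⋆⁻ {X = X} {H} {F} avoid (s , P , XF─H , F≢∅ , Pdel) =
  _ , Pure-⋆⁻ avoid P , ⋆-face⁻ {X = X} F#H XF─H , F≢∅ , Pure-del-⋆⁻ avoid F#H Pdel
  where
  F#H : Disjoint F H
  F#H = ⋆-shedding-face-disjoint avoid P XF─H Pdel

Decomp-⋆⁺ : X Avoids H → Decomp k X → Decomp k (X ⋆ H)
Decomp-⋆⁺ avoid (simplex s P X-simplex) = simplex _ (Pure-⋆⁺ avoid P) (IsSimplex-⋆⁺ avoid X-simplex)
Decomp-⋆⁺ {X = X} {H} avoid (shed s F P XF F≢∅ ∣F∣≤1+k Pdel del-decomp lk-decomp) =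
  shed _ F (Pure-⋆⁺ avoid P) (⋆-face⁺ {X = X} F#H XF) F≢∅ ∣F∣≤1+k (Pure-del-⋆⁺ avoid F#H Pdel)
    (Decomp-resp-≐ (≐-sym (del-⋆ {X = X} F#H)) (Decomp-⋆⁺ (avoid ∘ proj₁) del-decomp))
    (Decomp-resp-≐ (≐-sym (lk-⋆ {X = X} F#H)) (Decomp-⋆⁺ (avoid ∘ proj₁) lk-decomp))
  where
  F#H : Disjoint F H
  F#H = avoid XF

Decomp-⋆⁻ : X Avoids H → Y ≐ X ⋆ H → Decomp k Y → Decomp k X
Decomp-⋆⁻ avoid Y≐X⋆H (simplex s P Y-simplex) =
  simplex _ (Pure-⋆⁻ avoid (Pure-resp-≐ Y≐X⋆H P))
            (IsSimplex-⋆⁻ avoid (IsSimplex-resp-≐ Y≐X⋆H Y-simplex))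
Decomp-⋆⁻ {X = X} {H} {Y} avoid Y≐X⋆H (shed s F P YF F≢∅ ∣F∣≤1+k Pdel del-decomp lk-decomp) =
  shed _ F (Pure-⋆⁻ avoid P′) (⋆-face⁻ {X = X} F#H XF─H) F≢∅ ∣F∣≤1+k (Pure-del-⋆⁻ avoid F#H Pdel′)
    (Decomp-⋆⁻ (avoid ∘ proj₁) (≐-trans (del-resp-≐ Y≐X⋆H) (del-⋆ {X = X} F#H)) del-decomp)
    (Decomp-⋆⁻ (avoid ∘ proj₁) (≐-trans (lk-resp-≐ Y≐X⋆H) (lk-⋆ {X = X} F#H)) lk-decomp)
  where
  P′ : Pure s (X ⋆ H)
  P′ = Pure-resp-≐ Y≐X⋆H P

  XF─H : (X ⋆ H) F
  XF─H = proj₁ Y≐X⋆H YF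

  Pdel′ : Pure s (del F (X ⋆ H))
  Pdel′ = Pure-resp-≐ (del-resp-≐ Y≐X⋆H) Pdel

  F#H : Disjoint F H
  F#H = ⋆-shedding-face-disjoint avoid P′ XF─H Pdel′

⟨map-∪⟩≐⟨⟩⋆ : ∀ (Fs : List (Subset n)) H → ⟨ map (_∪ H) Fs ⟩ ≐ ⟨ Fs ⟩ ⋆ H
⟨map-∪⟩≐⟨⟩⋆ Fs H = to , from
  where
  to : ∀ {G} → ⟨ map (_∪ H) Fs ⟩ G → (⟨ Fs ⟩ ⋆ H) G
  to (F∪H , F∪H∈ , G⊆F∪H) with ∈-map⁻ (_∪ H) F∪H∈
  ... | F , F∈Fs , refl = F , F∈Fs , p⊆q∪r⇒p─r⊆q H G⊆F∪H

  from : ∀ {G} → (⟨ Fs ⟩ ⋆ H) G → ⟨ map (_∪ H) Fs ⟩ G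
  from (F , F∈Fs , G─H⊆F) = F ∪ H , ∈-map⁺ (_∪ H) F∈Fs , p─r⊆q⇒p⊆q∪r H G─H⊆F

⟨⟩-avoids : ∀ {Fs : List (Subset n)} → (∀ F → F ∈ Fs → Disjoint F H) → ⟨ Fs ⟩ Avoids H
⟨⟩-avoids Fs#H (F , F∈Fs , G⊆F) x x∈G = Fs#H F F∈Fs x (G⊆F x∈G)

lemma3p1 : ∀ {n} (Fs : List (Subset n)) (H : Subset n)
    → (∀ F → F ∈ Fs → Disjoint F H)
    → ∃[ s ] Pure s ⟨ Fs ⟩
    → (∀ (k : ℕ) → Decomp k ⟨ Fs ⟩ ⇔ Decomp k ⟨ map (_∪ H) Fs ⟩)
    × (∀ (F : Subset n) → ShedFace ⟨ Fs ⟩ F ⇔ ShedFace ⟨ map (_∪ H) Fs ⟩ F)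
lemma3p1 Fs H Fs#H _ =
    (λ k → mk⇔ (Decomp-resp-≐ (≐-sym D≐C⋆H) ∘ Decomp-⋆⁺ avoid)
               (Decomp-⋆⁻ avoid D≐C⋆H))
  , (λ F → mk⇔ (ShedFace-resp-≐ (≐-sym D≐C⋆H) ∘ ShedFace-⋆⁺ avoid)
               (ShedFace-⋆⁻ avoid ∘ ShedFace-resp-≐ D≐C⋆H))
  where
  D≐C⋆H : ⟨ map (_∪ H) Fs ⟩ ≐ ⟨ Fs ⟩ ⋆ H
  D≐C⋆H = ⟨map-∪⟩≐⟨⟩⋆ Fs H

  avoid : ⟨ Fs ⟩ Avoids H
  avoid = ⟨⟩-avoids Fs#H
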